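{- Let $V$ be a set with $n$ elements and let ${\cal S}=\{S_1,\ldots,S_m\}$ be a collection of subsets of $V$. For $i=1,\ldots,\lfloor n/2\rfloor$ let $m_i$ be the number of members of ${\cal S}$ of cardinality $i$. Then $$\kappa({\cal S})\geq\frac{\lfloor n/2\rfloor!}{n!}\sum_{i=1}^{\lfloor n/2\rfloor}\frac{(n-i)!\,2^i}{\lfloor n/2-i\rfloor!}\,m_i .$$
   Context: A permutation $\pi$ of $V$ inverts $S\subseteq V$ if $\pi(S)\cap S=\emptyset$. $\kappa({\cal S})$ denotes the maximum, over all permutations $\pi$ of $V$, of the number of members of ${\cal S}$ inverted by $\pi$. -}

module Defs where

open import Data.Nat using (ℕ; zero; suc; _∸_; _^_; _/_; _!; _≟_)
import Data.Nat as ℕ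
open import Data.Nat.Properties using (_!≢0)
open import Data.Integer using (+_)
open import Data.Rational as ℚ using (ℚ; 0ℚ)
open import Data.List using (List; []; _∷_; length; filter; map; upTo; foldr)
open import Data.Fin using (Fin)
open import Data.Fin.Subset using (Subset; _∈_; _∉_; ∣_∣)
open import Data.Fin.Subset.Properties using (_∈?_)
open import Data.Fin.Properties using (all?)
open import Data.Fin.Permutation using (Permutation′; _⟨$⟩ʳ_)
open import Relation.Nullary using (Dec; yes; no; ¬_)
open import Relation.Nullary.Decidable using (¬?)

-- Ground set V = Fin n.  A permutation π of V inverts S ⊆ V iff π(S) ∩ S = ∅,
-- i.e. no element of S is mapped by π into S.
Inverts : ∀ {n} → Permutation′ n → Subset n → Set
Inverts π S = ∀ x → x ∈ S → π ⟨$⟩ʳ x ∉ S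

inverts? : ∀ {n} (π : Permutation′ n) (S : Subset n) → Dec (Inverts π S)
inverts? π S = all? λ x → imp? (x ∈? S) (¬? (π ⟨$⟩ʳ x ∈? S))
  where
  imp? : ∀ {A B : Set} → Dec A → Dec B → Dec (A → B)
  imp? _ (yes b) = yes λ _ → b
  imp? (no ¬a) _ = yes λ a → Relation.Nullary.contradiction a ¬a
    where import Relation.Nullary
  imp? (yes a) (no ¬b) = no λ f → ¬b (f a)

numInverted : ∀ {n} → Permutation′ n → List (Subset n) → ℕ
numInverted π 𝒮 = length (filter (inverts? π) 𝒮)

card-count : ∀ {n} → List (Subset n) → ℕ → ℕ
card-count 𝒮 i = length (filter (λ S → ∣ S ∣ ≟ i) 𝒮)

divFact : ℕ → ℕ → ℚ
divFact k d = (+ k ℚ./ (d !)) {{d !≢0}}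

sumℚ : List ℚ → ℚ
sumℚ = foldr ℚ._+_ 0ℚ

-- the right-hand side:
-- (⌊n/2⌋! / n!) · Σ_{i=1}^{⌊n/2⌋} (n-i)! 2^i / ⌊n/2 - i⌋! · m_i
-- (for 1 ≤ i ≤ ⌊n/2⌋ we have ⌊n/2 - i⌋ = ⌊n/2⌋ - i)
bound : (n : ℕ) → List (Subset n) → ℚ
bound n 𝒮 =
  divFact ((n / 2) !) n ℚ.*
  sumℚ (map (λ i → divFact ((n ∸ i) ! ℕ.* 2 ^ i) ((n / 2) ∸ i) ℚ.* (+ card-count 𝒮 i ℚ./ 1))
            (map suc (upTo (n / 2))))

-- κ(𝒮) ≥ q  ⇔  some permutation inverts at least q members (κ is a max over
-- the finite nonempty set of permutations)
κ≥ : (n : ℕ) → List (Subset n) → ℚ → Set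
κ≥ n 𝒮 q = Data.Product.∃ λ (π : Permutation′ n) → q ℚ.≤ (+ numInverted π 𝒮 ℚ./ 1)
  where import Data.Product

module Submission where

-- A uniformly random perfect matching of n = 2k points, read as a fixed-point-free involution
-- (for n = 2k+1: one point stays fixed and the other 2k are matched), inverts a given i-set
-- with probability W(i)/W(0), where W(i)·(k−i)!·2^(k−i) = (n−i)!. The expected number of
-- inverted members of 𝒮 is therefore at least the bound, so some permutation attains it.
-- Matchings are built by choosing the partner of the first point (or the fixed point) and
-- recursing on the points left over. The proof follows this recursion with integer weights
-- in place of probabilities, and at each step keeps the best choice, which is at least the
-- average.

open import Defs
open import Data.Bool using (true; false)
import Data.Integer as ℤ
import Data.Integer.Properties as ℤP
open import Data.Fin using (Fin; zero; suc; punchIn; punchOut; _≟_)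
open import Data.Fin.Permutation as Perm using (Permutation′; _⟨$⟩ʳ_; insert; insert-punchIn)
open import Data.Fin.Properties using (punchIn-punchOut)
open import Data.Fin.Subset using (Subset; _∈_; _∉_; ∣_∣; ∁)
open import Data.Fin.Subset.Properties using (_∈?_; drop-there; ∣∁p∣≡n∸∣p∣)
open import Data.List using (List; []; _∷_; map; mapMaybe; filter; length; foldr; upTo)
open import Data.List.Properties using (map-cong; filter-accept; filter-reject)
open import Data.List.Relation.Unary.All as All using (All; []; _∷_)
import Data.List.Relation.Unary.All.Properties as All
open import Data.List.Relation.Unary.Unique.Propositional using (Unique; []; _∷_)
import Data.List.Relation.Unary.Unique.Propositional.Properties as Unique
open import Data.Maybe using (Maybe; just; nothing; maybe′)
import Data.Nat as ℕ
open import Data.Nat using (ℕ; zero; suc; _+_; _*_; _∸_; _^_; _/_; _%_; _!; _≤_; z≤n; s≤s; pred; NonZero)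
open import Data.Nat.DivMod using (m%n<n; m≡m%n+[m/n]*n)
open import Data.Nat.ListAction using (sum)
open import Data.Nat.Properties hiding (_≟_)
open import Algebra.Properties.CommutativeSemigroup +-commutativeSemigroup
  using (interchange) renaming (x∙yz≈y∙xz to x+[y+z]≡y+[x+z])
open import Algebra.Properties.CommutativeSemigroup *-commutativeSemigroup
  using () renaming (x∙yz≈y∙xz to x*[y*z]≡y*[x*z])
open import Algebra.Properties.Semiring.Sum +-*-semiring
  using (∑-distrib-+; *-distribˡ-sum; sum-replicate-zero) renaming (sum to ∑)
open import Data.Nat.Tactic.RingSolver using (solve-∀)
open import Data.Product using (∃; _×_; _,_; proj₁; proj₂)
open import Data.Rational as ℚ using (ℚ; toℚᵘ)
import Data.Rational.Properties as ℚP
open import Data.Rational.Unnormalised as ℚᵘ using (ℚᵘ; mkℚᵘ; ↥_; ↧_; *≤*; 0ℚᵘ)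
import Data.Rational.Unnormalised.Properties as ℚᵘP
open import Data.Sum using (_⊎_; inj₁; inj₂)
open import Data.Vec using (Vec; []; _∷_; lookup; removeAt; here; there)
open import Data.Vec.Properties using ([]=⇒lookup; lookup⇒[]=)
open import Function using (_∘_; case_of_)
open import Relation.Binary.PropositionalEquality
open import Relation.Nullary using (Dec; yes; no; ¬_; contradiction; _×-dec_)
open import Relation.Unary using (Decidable)

∑-mono-≤ : ∀ {c} {f g : Fin c → ℕ} → (∀ j → f j ≤ g j) → ∑ f ≤ ∑ g
∑-mono-≤ {zero}  _   = z≤n
∑-mono-≤ {suc c} f≤g = +-mono-≤ (f≤g zero) (∑-mono-≤ (f≤g ∘ suc))

∃-≥-average : ∀ c (N : Fin (suc c) → ℕ) → ∃ λ j → ∑ N ≤ suc c * N j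
∃-≥-average zero    N = zero , ≤-reflexive (cong (N zero +_) (sym (+-identityʳ _)))
∃-≥-average (suc c) N with ∃-≥-average c (N ∘ suc)
... | j , N≤ with N zero ≤? N (suc j)
...   | yes N₀≤Nⱼ = suc j , +-mono-≤ N₀≤Nⱼ N≤
...   | no  N₀≰Nⱼ =
  zero , +-monoʳ-≤ (N zero) (≤-trans N≤ (*-monoʳ-≤ (suc c) (<⇒≤ (≰⇒> N₀≰Nⱼ))))

module _ {A : Set} where

  sum-map-mono-≤ : ∀ (xs : List A) {f g : A → ℕ} → (∀ x → f x ≤ g x) →
                   sum (map f xs) ≤ sum (map g xs)
  sum-map-mono-≤ []       _   = z≤n
  sum-map-mono-≤ (x ∷ xs) f≤g = +-mono-≤ (f≤g x) (sum-map-mono-≤ xs f≤g)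

  sum-map-+ : ∀ (xs : List A) (f g : A → ℕ) →
              sum (map (λ x → f x + g x) xs) ≡ sum (map f xs) + sum (map g xs)
  sum-map-+ []       f g = refl
  sum-map-+ (x ∷ xs) f g rewrite sum-map-+ xs f g = interchange (f x) (g x) _ _

  sum-map-≡0 : ∀ {xs : List A} {f : A → ℕ} → All (λ x → f x ≡ 0) xs → sum (map f xs) ≡ 0
  sum-map-≡0 []           = refl
  sum-map-≡0 (fx≡0 ∷ all) = cong₂ _+_ fx≡0 (sum-map-≡0 all)

  sum-map-∑ : ∀ {c} (xs : List A) (g : Fin c → A → ℕ) →
              sum (map (λ x → ∑ λ j → g j x) xs) ≡ ∑ λ j → sum (map (g j) xs)
  sum-map-∑ {c} []  g = sym (sum-replicate-zero c)
  sum-map-∑ (x ∷ xs) g = trans (cong (∑ (λ j → g j x) +_) (sum-map-∑ xs g))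
                               (sym (∑-distrib-+ (λ j → g j x) _))

  sum-mapMaybe : ∀ {B : Set} (f : A → Maybe B) (w : B → ℕ) xs →
                 sum (map w (mapMaybe f xs)) ≡ sum (map (maybe′ w 0 ∘ f) xs)
  sum-mapMaybe f w []       = refl
  sum-mapMaybe f w (x ∷ xs) with f x
  ... | nothing = sum-mapMaybe f w xs
  ... | just y  = cong (w y +_) (sum-mapMaybe f w xs)

  length-filter-mapMaybe : ∀ {B : Set} {P : B → Set} {Q : A → Set} (P? : Decidable P) (Q? : Decidable Q)
    (f : A → Maybe B) → (∀ {x y} → f x ≡ just y → P y → Q x) →
    ∀ xs → length (filter P? (mapMaybe f xs)) ≤ length (filter Q? xs)
  length-filter-mapMaybe P? Q? f P⇒Q []       = z≤n
  length-filter-mapMaybe P? Q? f P⇒Q (x ∷ xs) with f x in fx | Q? x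
  ... | nothing | yes _ = m≤n⇒m≤1+n (length-filter-mapMaybe P? Q? f P⇒Q xs)
  ... | nothing | no  _ = length-filter-mapMaybe P? Q? f P⇒Q xs
  ... | just y  | yes _ with P? y
  ...   | yes _ = s≤s (length-filter-mapMaybe P? Q? f P⇒Q xs)
  ...   | no  _ = m≤n⇒m≤1+n (length-filter-mapMaybe P? Q? f P⇒Q xs)
  length-filter-mapMaybe P? Q? f P⇒Q (x ∷ xs) | just y | no ¬Qx with P? y
  ...   | yes Py = contradiction (P⇒Q fx Py) ¬Qx
  ...   | no  _  = length-filter-mapMaybe P? Q? f P⇒Q xs

lookup-removeAt : ∀ {A : Set} {n} (xs : Vec A (suc n)) i j →
                  lookup (removeAt xs i) j ≡ lookup xs (punchIn i j)
lookup-removeAt (x ∷ xs)     zero    j       = refl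
lookup-removeAt (x ∷ y ∷ xs) (suc i) zero    = refl
lookup-removeAt (x ∷ y ∷ xs) (suc i) (suc j) = lookup-removeAt (y ∷ xs) i j

module _ {n} {S : Subset (suc n)} {i : Fin (suc n)} where

  ∈-removeAt⁺ : ∀ {j} → punchIn i j ∈ S → j ∈ removeAt S i
  ∈-removeAt⁺ {j} ij∈S = lookup⇒[]= j _ (trans (lookup-removeAt S i j) ([]=⇒lookup ij∈S))

  ∣removeAt∣ : ∣ S ∣ ≡ ∣ lookup S i ∷ removeAt S i ∣
  ∣removeAt∣ = go S i
    where
    go : ∀ {m} (S : Subset (suc m)) i → ∣ S ∣ ≡ ∣ lookup S i ∷ removeAt S i ∣
    go (b ∷ S)     zero    = refl
    go (b ∷ c ∷ S) (suc i) with lookup (c ∷ S) i | go (c ∷ S) i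
    go (true  ∷ _) (suc i) | true  | e = cong suc e
    go (false ∷ _) (suc i) | true  | e = e
    go (true  ∷ _) (suc i) | false | e = cong suc e
    go (false ∷ _) (suc i) | false | e = e

  ∣removeAt∣-∉ : i ∉ S → ∣ removeAt S i ∣ ≡ ∣ S ∣
  ∣removeAt∣-∉ i∉S with lookup S i in Sᵢ | ∣removeAt∣
  ... | true  | _ = contradiction (lookup⇒[]= i S Sᵢ) i∉S
  ... | false | e = sym e

  ∣removeAt∣-∈ : i ∈ S → ∣ removeAt S i ∣ ≡ pred ∣ S ∣
  ∣removeAt∣-∈ i∈S with lookup S i | []=⇒lookup i∈S | ∣removeAt∣
  ... | true | refl | e = cong pred (sym e)

∣p∣*a+∣∁p∣*b≤∑ : ∀ {m} (p : Subset m) (g : Fin m → ℕ) {a b} →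
  (∀ j → j ∈ p → a ≤ g j) → (∀ j → j ∉ p → b ≤ g j) → ∣ p ∣ * a + ∣ ∁ p ∣ * b ≤ ∑ g
∣p∣*a+∣∁p∣*b≤∑ []      g a≤ b≤ = z≤n
∣p∣*a+∣∁p∣*b≤∑ (x ∷ p) g {a} {b} a≤ b≤
  with x | a≤ zero | b≤ zero
     | ∣p∣*a+∣∁p∣*b≤∑ p (g ∘ suc) (λ j → a≤ (suc j) ∘ there)
                               (λ j j∉p → b≤ (suc j) (j∉p ∘ drop-there))
... | true  | a≤g₀ | _    | rest = begin
  a + ∣ p ∣ * a + ∣ ∁ p ∣ * b   ≡⟨ +-assoc a _ _ ⟩
  a + (∣ p ∣ * a + ∣ ∁ p ∣ * b) ≤⟨ +-mono-≤ (a≤g₀ here) rest ⟩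
  g zero + ∑ (g ∘ suc)          ∎
  where open ≤-Reasoning
... | false | _    | b≤g₀ | rest = begin
  ∣ p ∣ * a + (b + ∣ ∁ p ∣ * b) ≡⟨ x+[y+z]≡y+[x+z] (∣ p ∣ * a) b _ ⟩
  b + (∣ p ∣ * a + ∣ ∁ p ∣ * b) ≤⟨ +-mono-≤ (b≤g₀ λ ()) rest ⟩
  g zero + ∑ (g ∘ suc)          ∎
  where open ≤-Reasoning

[m∸∣p∣]*b≤∑ : ∀ {m} (p : Subset m) (g : Fin m → ℕ) {b} →
  (∀ j → j ∉ p → b ≤ g j) → (m ∸ ∣ p ∣) * b ≤ ∑ g
[m∸∣p∣]*b≤∑ {m} p g {b} b≤ = begin
  (m ∸ ∣ p ∣) * b         ≡⟨ cong (_* b) (∣∁p∣≡n∸∣p∣ p) ⟨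
  ∣ ∁ p ∣ * b             ≡⟨ cong (_+ ∣ ∁ p ∣ * b) (*-zeroʳ ∣ p ∣) ⟨
  ∣ p ∣ * 0 + ∣ ∁ p ∣ * b ≤⟨ ∣p∣*a+∣∁p∣*b≤∑ p g (λ _ _ → z≤n) b≤ ⟩
  ∑ g                     ∎
  where open ≤-Reasoning

punchIn-view : ∀ {n} (i x : Fin (suc n)) → x ≡ i ⊎ ∃ λ j → x ≡ punchIn i j
punchIn-view i x with i ≟ x
... | yes i≡x = inj₁ (sym i≡x)
... | no  i≢x = inj₂ (punchOut i≢x , sym (punchIn-punchOut i≢x))

insert-at : ∀ {n} i j (σ : Permutation′ n) → insert i j σ ⟨$⟩ʳ i ≡ j
insert-at i j σ with i ≟ i
... | yes _   = refl
... | no  i≢i = contradiction refl i≢i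

Separates : ∀ {n} → Permutation′ n → Subset n → Subset n → Set
Separates π A B = ∀ x → x ∈ A → π ⟨$⟩ʳ x ∉ B

insert-separates : ∀ {n} {i j : Fin (suc n)} {σ : Permutation′ n} {A B : Subset (suc n)} →
  (i ∈ A → j ∉ B) → Separates σ (removeAt A i) (removeAt B j) → Separates (insert i j σ) A B
insert-separates {i = i} {j} {σ} i∈A⇒j∉B sep x x∈A with punchIn-view i x
... | inj₁ refl rewrite insert-at i j σ = i∈A⇒j∉B x∈A
... | inj₂ (y , refl) rewrite insert-punchIn i j σ y =
  λ σy∈B → sep y (∈-removeAt⁺ x∈A) (∈-removeAt⁺ σy∈B)

κ-Bound : (n : ℕ) → (Subset n → ℕ) → ℕ → Set
κ-Bound n w T = ∀ 𝒮 → ∃ λ (π : Permutation′ n) → sum (map w 𝒮) ≤ T * numInverted π 𝒮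

record Restriction (n m : ℕ) : Set where
  field
    restrict       : Subset n → Maybe (Subset m)
    extend         : Permutation′ m → Permutation′ n
    extend-inverts : ∀ π {S S′} → restrict S ≡ just S′ → Inverts π S′ → Inverts (extend π) S

  pullback : (Subset m → ℕ) → Subset n → ℕ
  pullback w = maybe′ w 0 ∘ restrict

  pullback-size : ∀ W {S S′ s} → restrict S ≡ just S′ → ∣ S′ ∣ ≡ s →
                  W s ≤ pullback (W ∘ ∣_∣) S
  pullback-size W eq refl = ≤-reflexive (sym (cong (maybe′ (W ∘ ∣_∣) 0) eq))

open Restriction

κ-Bound-restrict : ∀ {n m w T} (ρ : Restriction n m) → κ-Bound m w T →
  ∀ 𝒮 → ∃ λ π → sum (map (pullback ρ w) 𝒮) ≤ T * numInverted π 𝒮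
κ-Bound-restrict {w = w} {T} ρ κ-w 𝒮 with κ-w (mapMaybe (restrict ρ) 𝒮)
... | π , w≤ = extend ρ π , (begin
  sum (map (pullback ρ w) 𝒮)                  ≡⟨ sum-mapMaybe (restrict ρ) w 𝒮 ⟨
  sum (map w (mapMaybe (restrict ρ) 𝒮))       ≤⟨ w≤ ⟩
  T * numInverted π (mapMaybe (restrict ρ) 𝒮) ≤⟨ *-monoʳ-≤ T (length-filter-mapMaybe (inverts? π)
                                                   (inverts? (extend ρ π)) (restrict ρ) (extend-inverts ρ π) 𝒮) ⟩
  T * numInverted (extend ρ π) 𝒮              ∎)
  where open ≤-Reasoning

κ-Bound-average : ∀ {n m c w v T} (ρ : Fin (suc c) → Restriction n m) →
  (∀ S → v S ≤ ∑ λ j → pullback (ρ j) w S) →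
  κ-Bound m w T → κ-Bound n v (suc c * T)
κ-Bound-average {c = c} {w} {v} {T} ρ v≤ κ-w 𝒮 = π j* , (begin
  sum (map v 𝒮)                                  ≤⟨ sum-map-mono-≤ 𝒮 v≤ ⟩
  sum (map (λ S → ∑ λ j → pullback (ρ j) w S) 𝒮) ≡⟨ sum-map-∑ 𝒮 (λ j → pullback (ρ j) w) ⟩
  (∑ λ j → sum (map (pullback (ρ j) w) 𝒮))       ≤⟨ ∑-mono-≤ (proj₂ ∘ best) ⟩
  (∑ λ j → T * N j)                              ≡⟨ *-distribˡ-sum T N ⟨
  T * ∑ N                                        ≤⟨ *-monoʳ-≤ T (proj₂ (∃-≥-average c N)) ⟩
  T * (suc c * N j*)                             ≡⟨ *-assoc T (suc c) (N j*) ⟨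
  T * suc c * N j*                               ≡⟨ cong (_* N j*) (*-comm T (suc c)) ⟩
  suc c * T * N j*                               ∎)
  where
  open ≤-Reasoning
  best : ∀ j → ∃ λ π → sum (map (pullback (ρ j) w) 𝒮) ≤ T * numInverted π 𝒮
  best j = κ-Bound-restrict {T = T} (ρ j) κ-w 𝒮
  π : Fin (suc c) → Permutation′ _
  π = proj₁ ∘ best
  N : Fin (suc c) → ℕ
  N j = numInverted (π j) 𝒮
  j* : Fin (suc c)
  j* = proj₁ (∃-≥-average c N)

unless : ∀ {P A : Set} → Dec P → A → Maybe A
unless (yes _) _ = nothing
unless (no  _) a = just a

unless-¬ : ∀ {P A : Set} (P? : Dec P) {a : A} → ¬ P → unless P? a ≡ just a
unless-¬ (yes p) ¬p = contradiction p ¬p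
unless-¬ (no  _) _  = refl

unless-just : ∀ {P A : Set} (P? : Dec P) {a b : A} → unless P? a ≡ just b → ¬ P × a ≡ b
unless-just (no ¬p) refl = ¬p , refl

fixing : ∀ {m} → Fin (suc m) → Restriction (suc m) m
fixing f = record
  { restrict       = λ S → unless (f ∈? S) (removeAt S f)
  ; extend         = insert f f
  ; extend-inverts = λ π {S} eq inv → case unless-just (f ∈? S) eq of λ where
      (f∉S , refl) → insert-separates (λ f∈S → contradiction f∈S f∉S) inv
  }

fixing-restrict : ∀ {m} (f : Fin (suc m)) S → f ∉ S → restrict (fixing f) S ≡ just (removeAt S f)
fixing-restrict f S = unless-¬ (f ∈? S)

-- The extension swaps 0 and j+1 and acts as π on the other points.
pairing : ∀ {m} → Fin (suc m) → Restriction (suc (suc m)) m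
pairing j = record
  { restrict       = λ S → unless (zero ∈? S ×-dec suc j ∈? S) (removeAt (removeAt S zero) j)
  ; extend         = λ π → insert zero (suc j) (insert j zero π)
  ; extend-inverts = λ { π {b ∷ c ∷ S} eq inv →
      case unless-just (zero ∈? (b ∷ c ∷ S) ×-dec suc j ∈? (b ∷ c ∷ S)) eq of λ where
        (¬both , refl) → insert-separates {i = zero} {suc j} (λ 0∈S j+1∈S → ¬both (0∈S , j+1∈S))
                           (insert-separates {i = j} {zero} (λ { j∈S here → ¬both (here , there j∈S) }) inv) }
  }

pairing-restrict : ∀ {m} (j : Fin (suc m)) b S → ¬ (b ≡ true × j ∈ S) →
                   restrict (pairing j) (b ∷ S) ≡ just (removeAt S j)
pairing-restrict j b S ¬both =
  unless-¬ (zero ∈? (b ∷ S) ×-dec suc j ∈? (b ∷ S)) λ { (here , there j∈S) → ¬both (refl , j∈S) }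

-- evenWeight k i = (2k−i)!/((k−i)!·2^(k−i)) counts the perfect matchings of 2k points that
-- pair every point of a given i-set with a point outside it; oddWeight k i counts the same
-- for 2k+1 points, one of which (outside the set) stays unmatched.
evenWeight : ℕ → ℕ → ℕ
evenWeight zero    zero    = 1
evenWeight zero    (suc i) = 0
evenWeight (suc k) zero    = suc (k + k) * evenWeight k 0
evenWeight (suc k) (suc i) = (suc (k + k) ∸ i) * evenWeight k i

oddWeight : ℕ → ℕ → ℕ
oddWeight k i = (suc (k + k) ∸ i) * evenWeight k i

evenWeight-ratio : ∀ k r → (k + k ∸ r) * evenWeight k (suc r) ≡ (k + k ∸ (r + r)) * evenWeight k r
evenWeight-ratio zero    r       = trans (*-zeroʳ (0 ∸ r)) (sym (cong (_* evenWeight 0 r) (0∸n≡0 (r + r))))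
evenWeight-ratio (suc k) zero    = refl
evenWeight-ratio (suc k) (suc r) rewrite +-suc k k | +-suc r r =
  trans (cong ((suc (k + k) ∸ r) *_) (evenWeight-ratio k r))
        (x*[y*z]≡y*[x*z] (suc (k + k) ∸ r) (k + k ∸ (r + r)) (evenWeight k r))

evenWeight-split : ∀ k s →
  evenWeight (suc k) s ≤ s * evenWeight k (pred s) + (suc (k + k) ∸ s) * evenWeight k s
evenWeight-split k zero    = ≤-refl
evenWeight-split k (suc r) = begin
  (suc (k + k) ∸ r) * evenWeight k r                          ≤⟨ *-monoˡ-≤ (evenWeight k r) ∸-bound ⟩
  (suc r + (k + k ∸ (r + r))) * evenWeight k r                ≡⟨ *-distribʳ-+ (evenWeight k r) (suc r) _ ⟩
  suc r * evenWeight k r + (k + k ∸ (r + r)) * evenWeight k r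
    ≡⟨ cong (suc r * evenWeight k r +_) (evenWeight-ratio k r) ⟨
  suc r * evenWeight k r + (k + k ∸ r) * evenWeight k (suc r) ∎
  where
  open ≤-Reasoning
  ∸-bound : suc (k + k) ∸ r ≤ suc r + (k + k ∸ (r + r))
  ∸-bound = m≤n+o⇒m∸n≤o (suc (k + k)) r (begin
    suc (k + k)                       ≤⟨ s≤s (m≤n+m∸n (k + k) (r + r)) ⟩
    suc (r + r + (k + k ∸ (r + r)))   ≡⟨ cong suc (+-assoc r r _) ⟩
    suc (r + (r + (k + k ∸ (r + r)))) ≡⟨ +-suc r _ ⟨
    r + (suc r + (k + k ∸ (r + r)))   ∎)

[1+m∸n]*[m∸n]!≡[1+m∸n]! : ∀ m n → n ≤ m → (suc m ∸ n) * (m ∸ n) ! ≡ (suc m ∸ n) !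
[1+m∸n]*[m∸n]!≡[1+m∸n]! m n n≤m rewrite +-∸-assoc 1 n≤m = refl

evenWeight-closed : ∀ k i → i ≤ k → evenWeight k i * ((k ∸ i) ! * 2 ^ (k ∸ i)) ≡ (k + k ∸ i) !
oddWeight-closed  : ∀ k i → i ≤ k → oddWeight k i * ((k ∸ i) ! * 2 ^ (k ∸ i)) ≡ (suc (k + k) ∸ i) !

oddWeight-closed k i i≤k = begin
  (suc (k + k) ∸ i) * evenWeight k i * ((k ∸ i) ! * 2 ^ (k ∸ i))
    ≡⟨ *-assoc (suc (k + k) ∸ i) _ _ ⟩
  (suc (k + k) ∸ i) * (evenWeight k i * ((k ∸ i) ! * 2 ^ (k ∸ i)))
    ≡⟨ cong ((suc (k + k) ∸ i) *_) (evenWeight-closed k i i≤k) ⟩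
  (suc (k + k) ∸ i) * (k + k ∸ i) !
    ≡⟨ [1+m∸n]*[m∸n]!≡[1+m∸n]! (k + k) i (≤-trans i≤k (m≤m+n k k)) ⟩
  (suc (k + k) ∸ i) ! ∎
  where open ≡-Reasoning

evenWeight-closed zero    zero    z≤n       = refl
evenWeight-closed (suc k) zero    z≤n       = begin
  suc (k + k) * evenWeight k 0 * (suc k * k ! * (2 * 2 ^ k))
    ≡⟨ 2[1+k]≡2+2k k (evenWeight k 0) (k !) (2 ^ k) ⟩
  suc (suc (k + k)) * (suc (k + k) * (evenWeight k 0 * (k ! * 2 ^ k)))
    ≡⟨ cong (λ x → suc (suc (k + k)) * (suc (k + k) * x)) (evenWeight-closed k 0 z≤n) ⟩
  suc (suc (k + k)) * (suc (k + k) * (k + k) !)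
    ≡⟨ cong (λ x → suc x !) (+-suc k k) ⟨
  suc (k + suc k) ! ∎
  where
  open ≡-Reasoning
  2[1+k]≡2+2k : ∀ k w f p →
    suc (k + k) * w * (suc k * f * (2 * p)) ≡ suc (suc (k + k)) * (suc (k + k) * (w * (f * p)))
  2[1+k]≡2+2k = solve-∀
evenWeight-closed (suc k) (suc i) (s≤s i≤k) =
  trans (oddWeight-closed k i i≤k) (cong (λ x → (x ∸ i) !) (sym (+-suc k k)))

fixing-covers : ∀ k (S : Subset (suc (k + k))) →
  oddWeight k ∣ S ∣ ≤ ∑ λ f → pullback (fixing f) (evenWeight k ∘ ∣_∣) S
fixing-covers k S = [m∸∣p∣]*b≤∑ S _ λ f f∉S →
  pullback-size (fixing f) (evenWeight k) (fixing-restrict f S f∉S) (∣removeAt∣-∉ f∉S)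

pairing-covers : ∀ k (S : Subset (suc (suc (k + k)))) →
  evenWeight (suc k) ∣ S ∣ ≤ ∑ λ j → pullback (pairing j) (evenWeight k ∘ ∣_∣) S
pairing-covers k (true ∷ S) = [m∸∣p∣]*b≤∑ S _ λ j j∉S →
  pullback-size (pairing j) (evenWeight k) (pairing-restrict j true S (j∉S ∘ proj₂))
                (∣removeAt∣-∉ j∉S)
pairing-covers k (false ∷ S) = begin
  evenWeight (suc k) ∣ S ∣
    ≤⟨ evenWeight-split k ∣ S ∣ ⟩
  ∣ S ∣ * evenWeight k (pred ∣ S ∣) + (suc (k + k) ∸ ∣ S ∣) * evenWeight k ∣ S ∣
    ≡⟨ cong (λ c → ∣ S ∣ * evenWeight k (pred ∣ S ∣) + c * evenWeight k ∣ S ∣)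
            (∣∁p∣≡n∸∣p∣ S) ⟨
  ∣ S ∣ * evenWeight k (pred ∣ S ∣) + ∣ ∁ S ∣ * evenWeight k ∣ S ∣
    ≤⟨ ∣p∣*a+∣∁p∣*b≤∑ S _ (λ j j∈S → restricted j (∣removeAt∣-∈ j∈S))
                          (λ j j∉S → restricted j (∣removeAt∣-∉ j∉S)) ⟩
  (∑ λ j → pullback (pairing j) (evenWeight k ∘ ∣_∣) (false ∷ S)) ∎
  where
  open ≤-Reasoning
  restricted : ∀ j {s} → ∣ removeAt S j ∣ ≡ s →
               evenWeight k s ≤ pullback (pairing j) (evenWeight k ∘ ∣_∣) (false ∷ S)
  restricted j = pullback-size (pairing j) (evenWeight k) {false ∷ S}
                   (pairing-restrict j false S λ { (() , _) })

κ-Bound-0 : κ-Bound 0 (evenWeight 0 ∘ ∣_∣) 1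
κ-Bound-0 𝒮 = Perm.id , ≤-reflexive (trans (all-inverted 𝒮) (sym (*-identityˡ _)))
  where
  all-inverted : ∀ 𝒮 → sum (map (evenWeight 0 ∘ ∣_∣) 𝒮) ≡ numInverted Perm.id 𝒮
  all-inverted []       = refl
  all-inverted ([] ∷ 𝒮) = cong suc (all-inverted 𝒮)

κ-Bound-even : ∀ k → κ-Bound (k + k) (evenWeight k ∘ ∣_∣) (evenWeight k 0)
κ-Bound-even zero    = κ-Bound-0
κ-Bound-even (suc k) = subst (λ n → κ-Bound n (evenWeight (suc k) ∘ ∣_∣) (evenWeight (suc k) 0))
  (cong suc (sym (+-suc k k)))
  (κ-Bound-average {T = evenWeight k 0} pairing (pairing-covers k) (κ-Bound-even k))

κ-Bound-odd : ∀ k → κ-Bound (suc (k + k)) (oddWeight k ∘ ∣_∣) (oddWeight k 0)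
κ-Bound-odd k = κ-Bound-average {T = evenWeight k 0} fixing (fixing-covers k) (κ-Bound-even k)

𝟙[_≡_] : ℕ → ℕ → ℕ
𝟙[ s ≡ i ] with s ℕ.≟ i
... | yes _ = 1
... | no  _ = 0

card-count-∷ : ∀ {n} (S : Subset n) 𝒮 i →
               card-count (S ∷ 𝒮) i ≡ 𝟙[ ∣ S ∣ ≡ i ] + card-count 𝒮 i
card-count-∷ S 𝒮 i with ∣ S ∣ ℕ.≟ i
... | yes ∣S∣≡i = cong length (filter-accept (λ S → ∣ S ∣ ℕ.≟ i) {x = S} {xs = 𝒮} ∣S∣≡i)
... | no  ∣S∣≢i = cong length (filter-reject (λ S → ∣ S ∣ ℕ.≟ i) {x = S} {xs = 𝒮} ∣S∣≢i)

sum-map-*𝟙≤ : ∀ (W : ℕ → ℕ) s {L} → Unique L → sum (map (λ i → W i * 𝟙[ s ≡ i ]) L) ≤ W s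
sum-map-*𝟙≤ W s []                     = z≤n
sum-map-*𝟙≤ W s {i ∷ L} (i∉L ∷ unique) with s ℕ.≟ i
... | yes refl = ≤-reflexive (trans (cong₂ _+_ (*-identityʳ (W s)) (sum-map-≡0 (All.map missed i∉L)))
                                   (+-identityʳ (W s)))
  where
  missed : ∀ {j} → s ≢ j → W j * 𝟙[ s ≡ j ] ≡ 0
  missed {j} s≢j with s ℕ.≟ j
  ... | yes s≡j = contradiction s≡j s≢j
  ... | no  _   = *-zeroʳ (W j)
... | no  _    = ≤-trans (≤-reflexive (cong (_+ sum (map (λ i → W i * 𝟙[ s ≡ i ]) L)) (*-zeroʳ (W i))))
                         (sum-map-*𝟙≤ W s unique)

sum-map-*card-count≤ : ∀ {n} (W : ℕ → ℕ) {L} → Unique L →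
  (𝒮 : List (Subset n)) → sum (map (λ i → W i * card-count 𝒮 i) L) ≤ sum (map (W ∘ ∣_∣) 𝒮)
sum-map-*card-count≤ W {L} unique []       =
  ≤-reflexive (sum-map-≡0 (All.universal (λ i → *-zeroʳ (W i)) L))
sum-map-*card-count≤ W {L} unique (S ∷ 𝒮) = begin
  sum (map (λ i → W i * card-count (S ∷ 𝒮) i) L)
    ≡⟨ cong sum (map-cong (λ i → trans (cong (W i *_) (card-count-∷ S 𝒮 i))
                                       (*-distribˡ-+ (W i) _ _)) L) ⟩
  sum (map (λ i → W i * 𝟙[ ∣ S ∣ ≡ i ] + W i * card-count 𝒮 i) L)
    ≡⟨ sum-map-+ L _ _ ⟩
  sum (map (λ i → W i * 𝟙[ ∣ S ∣ ≡ i ]) L) + sum (map (λ i → W i * card-count 𝒮 i) L)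
    ≤⟨ +-mono-≤ (sum-map-*𝟙≤ W ∣ S ∣ unique) (sum-map-*card-count≤ W unique 𝒮) ⟩
  W ∣ S ∣ + sum (map (W ∘ ∣_∣) 𝒮) ∎
  where open ≤-Reasoning

-- ℚᵘ computes with representatives, so tracking them exactly turns each (in)equality between
-- fractions below into one between natural numbers.
record IsRatio (p : ℚᵘ) (a d : ℕ) : Set where
  constructor ratio
  field
    ↥≡ : ↥ p ≡ ℤ.+ a
    ↧≡ : ↧ p ≡ ℤ.+ d

module _ {a b d e : ℕ} where

  IsRatio-* : ∀ {p q} → IsRatio p a d → IsRatio q b e → IsRatio (p ℚᵘ.* q) (a * b) (d * e)
  IsRatio-* {mkℚᵘ _ _} {mkℚᵘ _ _} (ratio ↥p ↧p) (ratio ↥q ↧q) =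
    ratio (trans (cong₂ ℤ._*_ ↥p ↥q) (sym (ℤP.pos-* a b)))
          (trans (cong₂ ℤ._*_ ↧p ↧q) (sym (ℤP.pos-* d e)))

  IsRatio-+ : ∀ {p q} → IsRatio p a d → IsRatio q b e → IsRatio (p ℚᵘ.+ q) (a * e + b * d) (d * e)
  IsRatio-+ {mkℚᵘ _ _} {mkℚᵘ _ _} (ratio ↥p ↧p) (ratio ↥q ↧q) =
    ratio (trans (cong₂ ℤ._+_ (trans (cong₂ ℤ._*_ ↥p ↧q) (sym (ℤP.pos-* a e)))
                              (trans (cong₂ ℤ._*_ ↥q ↧p) (sym (ℤP.pos-* b d))))
                 (sym (ℤP.pos-+ (a * e) (b * d))))
          (trans (cong₂ ℤ._*_ ↧p ↧q) (sym (ℤP.pos-* d e)))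

  IsRatio-≤ : ∀ {p q} → IsRatio p a d → IsRatio q b e → a * e ≤ b * d → p ℚᵘ.≤ q
  IsRatio-≤ (ratio ↥p ↧p) (ratio ↥q ↧q) ae≤bd = *≤* (subst₂ ℤ._≤_
    (sym (trans (cong₂ ℤ._*_ ↥p ↧q) (sym (ℤP.pos-* a e))))
    (sym (trans (cong₂ ℤ._*_ ↥q ↧p) (sym (ℤP.pos-* b d))))
    (ℤ.+≤+ ae≤bd))

IsRatio-/ : ∀ a d .{{_ : NonZero d}} → IsRatio (ℤ.+ a ℚᵘ./ d) a d
IsRatio-/ a (suc d) = ratio refl refl

toℚᵘ-/ : ∀ a d .{{_ : NonZero d}} → toℚᵘ (ℤ.+ a ℚ./ d) ℚᵘ.≃ (ℤ.+ a ℚᵘ./ d)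
toℚᵘ-/ a (suc d) = ℚP.toℚᵘ-fromℚᵘ (mkℚᵘ (ℤ.+ a) d)

sumᵘ : List ℚᵘ → ℚᵘ
sumᵘ = foldr ℚᵘ._+_ 0ℚᵘ

toℚᵘ-sumℚ : ∀ qs → toℚᵘ (sumℚ qs) ℚᵘ.≃ sumᵘ (map toℚᵘ qs)
toℚᵘ-sumℚ []       = ℚᵘP.≃-refl
toℚᵘ-sumℚ (q ∷ qs) =
  ℚᵘP.≃-trans (ℚP.toℚᵘ-homo-+ q (sumℚ qs)) (ℚᵘP.+-congʳ (toℚᵘ q) (toℚᵘ-sumℚ qs))

module _ (n : ℕ) (W : ℕ → ℕ)
  (closed : ∀ i → i ≤ n / 2 → W i * ((n / 2 ∸ i) ! * 2 ^ (n / 2 ∸ i)) ≡ (n ∸ i) !) where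

  private
    k : ℕ
    k = n / 2

    instance
      W₀≢0 : NonZero (W 0)
      W₀≢0 = m*n≢0⇒m≢0 (W 0) {{subst NonZero (sym (closed 0 z≤n)) (n !≢0)}}

    prefactor : ℚᵘ
    prefactor = toℚᵘ (divFact (k !) n)

    term : ℕ → ℕ → ℚ
    term c i = divFact ((n ∸ i) ! * 2 ^ i) (k ∸ i) ℚ.* (ℤ.+ c ℚ./ 1)

  prefactor*term≤ : ∀ c i → i ≤ k →
                    prefactor ℚᵘ.* toℚᵘ (term c i) ℚᵘ.≤ (ℤ.+ (W i * c) ℚᵘ./ W 0)
  prefactor*term≤ c i i≤k = ℚᵘP.≤-respˡ-≃ (ℚᵘP.≃-sym as-ratios) (IsRatio-≤
    (IsRatio-* (IsRatio-/ (k !) (n !)) (IsRatio-* (IsRatio-/ ((n ∸ i) ! * 2 ^ i) ((k ∸ i) !)) (IsRatio-/ c 1)))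
    (IsRatio-/ (W i * c) (W 0))
    (≤-reflexive cross-multiplied))
    where
    instance
      [k∸i]!≢0 : NonZero ((k ∸ i) !)
      [k∸i]!≢0 = (k ∸ i) !≢0
      n!≢0 : NonZero (n !)
      n!≢0 = n !≢0
    as-ratios : prefactor ℚᵘ.* toℚᵘ (term c i) ℚᵘ.≃
                (ℤ.+ (k !) ℚᵘ./ n !) ℚᵘ.*
                ((ℤ.+ ((n ∸ i) ! * 2 ^ i) ℚᵘ./ (k ∸ i) !) ℚᵘ.* (ℤ.+ c ℚᵘ./ 1))
    as-ratios = ℚᵘP.*-cong (toℚᵘ-/ (k !) (n !))
      (ℚᵘP.≃-trans (ℚP.toℚᵘ-homo-* (divFact ((n ∸ i) ! * 2 ^ i) (k ∸ i)) (ℤ.+ c ℚ./ 1))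
                   (ℚᵘP.*-cong (toℚᵘ-/ ((n ∸ i) ! * 2 ^ i) ((k ∸ i) !)) (toℚᵘ-/ c 1)))
    2^k-split : 2 ^ k ≡ 2 ^ (k ∸ i) * 2 ^ i
    2^k-split = trans (cong (2 ^_) (sym (m∸n+n≡m i≤k))) (^-distribˡ-+-* 2 (k ∸ i) i)
    rearrange : ∀ f w₀ wᵢ g p q c →
                f * (wᵢ * (g * p) * q * c) * w₀ ≡ wᵢ * c * (w₀ * (f * (p * q)) * (g * 1))
    rearrange = solve-∀
    open ≡-Reasoning
    cross-multiplied : k ! * ((n ∸ i) ! * 2 ^ i * c) * W 0 ≡ W i * c * (n ! * ((k ∸ i) ! * 1))
    cross-multiplied = begin
      k ! * ((n ∸ i) ! * 2 ^ i * c) * W 0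
        ≡⟨ cong (λ x → k ! * (x * 2 ^ i * c) * W 0) (closed i i≤k) ⟨
      k ! * (W i * ((k ∸ i) ! * 2 ^ (k ∸ i)) * 2 ^ i * c) * W 0
        ≡⟨ rearrange (k !) (W 0) (W i) ((k ∸ i) !) (2 ^ (k ∸ i)) (2 ^ i) c ⟩
      W i * c * (W 0 * (k ! * (2 ^ (k ∸ i) * 2 ^ i)) * ((k ∸ i) ! * 1))
        ≡⟨ cong (λ x → W i * c * (W 0 * (k ! * x) * ((k ∸ i) ! * 1))) 2^k-split ⟨
      W i * c * (W 0 * (k ! * 2 ^ k) * ((k ∸ i) ! * 1))
        ≡⟨ cong (λ x → W i * c * (x * ((k ∸ i) ! * 1))) (closed 0 z≤n) ⟩
      W i * c * (n ! * ((k ∸ i) ! * 1)) ∎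

  prefactor*sum≤ : ∀ (count : ℕ → ℕ) L → All (_≤ k) L →
    prefactor ℚᵘ.* sumᵘ (map toℚᵘ (map (λ i → term (count i) i) L))
      ℚᵘ.≤ (ℤ.+ sum (map (λ i → W i * count i) L) ℚᵘ./ W 0)
  prefactor*sum≤ count []      []          =
    ℚᵘP.≤-respˡ-≃ (ℚᵘP.≃-sym (ℚᵘP.*-zeroʳ prefactor))
                  (IsRatio-≤ (IsRatio-/ 0 1) (IsRatio-/ 0 (W 0)) z≤n)
  prefactor*sum≤ count (i ∷ L) (i≤k ∷ L≤k) = begin
    prefactor ℚᵘ.* (toℚᵘ (term (count i) i) ℚᵘ.+ rest)
      ≃⟨ ℚᵘP.*-distribˡ-+ prefactor _ _ ⟩
    prefactor ℚᵘ.* toℚᵘ (term (count i) i) ℚᵘ.+ prefactor ℚᵘ.* rest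
      ≤⟨ ℚᵘP.+-mono-≤ (prefactor*term≤ (count i) i i≤k) (prefactor*sum≤ count L L≤k) ⟩
    (ℤ.+ a ℚᵘ./ W 0) ℚᵘ.+ (ℤ.+ b ℚᵘ./ W 0)
      ≤⟨ IsRatio-≤ (IsRatio-+ (IsRatio-/ a (W 0)) (IsRatio-/ b (W 0))) (IsRatio-/ (a + b) (W 0))
                   (≤-reflexive (common-denominator a b (W 0))) ⟩
    ℤ.+ (a + b) ℚᵘ./ W 0 ∎
    where
    open ℚᵘP.≤-Reasoning
    rest : ℚᵘ
    rest = sumᵘ (map toℚᵘ (map (λ i → term (count i) i) L))
    a b : ℕ
    a = W i * count i
    b = sum (map (λ i → W i * count i) L)
    common-denominator : ∀ a b w → (a * w + b * w) * w ≡ (a + b) * (w * w)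
    common-denominator = solve-∀

  κ≥-bound : κ-Bound n (W ∘ ∣_∣) (W 0) → ∀ 𝒮 → κ≥ n 𝒮 (bound n 𝒮)
  κ≥-bound κ-W 𝒮 = π , ℚP.toℚᵘ-cancel-≤ (begin
    toℚᵘ (bound n 𝒮)
      ≃⟨ ℚP.toℚᵘ-homo-* (divFact (k !) n) (sumℚ terms) ⟩
    prefactor ℚᵘ.* toℚᵘ (sumℚ terms)
      ≃⟨ ℚᵘP.*-congˡ {prefactor} (toℚᵘ-sumℚ terms) ⟩
    prefactor ℚᵘ.* sumᵘ (map toℚᵘ terms)
      ≤⟨ prefactor*sum≤ (card-count 𝒮) L (All.map⁺ (All.all-upTo k)) ⟩
    ℤ.+ total ℚᵘ./ W 0
      ≤⟨ IsRatio-≤ (IsRatio-/ total (W 0)) (IsRatio-/ N 1) total*1≤N*W₀ ⟩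
    ℤ.+ N ℚᵘ./ 1
      ≃⟨ toℚᵘ-/ N 1 ⟨
    toℚᵘ (ℤ.+ N ℚ./ 1) ∎)
    where
    open ℚᵘP.≤-Reasoning
    L : List ℕ
    L = map suc (upTo k)
    terms : List ℚ
    terms = map (λ i → term (card-count 𝒮 i) i) L
    total : ℕ
    total = sum (map (λ i → W i * card-count 𝒮 i) L)
    π : Permutation′ n
    π = proj₁ (κ-W 𝒮)
    N : ℕ
    N = numInverted π 𝒮
    total*1≤N*W₀ : total * 1 ≤ N * W 0
    total*1≤N*W₀ = ≤-trans (≤-reflexive (*-identityʳ total))
      (≤-trans (sum-map-*card-count≤ W (Unique.map⁺ suc-injective (Unique.upTo⁺ k)) 𝒮)
        (≤-trans (proj₂ (κ-W 𝒮)) (≤-reflexive (*-comm (W 0) N))))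

κ≥-bound-via : ∀ {n m} (W : ℕ → ℕ) → n ≡ m →
  (∀ i → i ≤ n / 2 → W i * ((n / 2 ∸ i) ! * 2 ^ (n / 2 ∸ i)) ≡ (m ∸ i) !) →
  κ-Bound m (W ∘ ∣_∣) (W 0) → ∀ 𝒮 → κ≥ n 𝒮 (bound n 𝒮)
κ≥-bound-via W refl closed = κ≥-bound _ W closed

m*2≡m+m : ∀ m → m * 2 ≡ m + m
m*2≡m+m m = trans (*-suc m 1) (cong (m +_) (*-identityʳ m))

even-or-odd : ∀ n → n ≡ n / 2 + n / 2 ⊎ n ≡ suc (n / 2 + n / 2)
even-or-odd n with n % 2 | m%n<n n 2 | m≡m%n+[m/n]*n n 2
... | 0           | _            | n≡ = inj₁ (trans n≡ (m*2≡m+m (n / 2)))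
... | 1           | _            | n≡ = inj₂ (trans n≡ (cong suc (m*2≡m+m (n / 2))))
... | suc (suc _) | s≤s (s≤s ()) | _

theorem2p3 : (n : ℕ) (𝒮 : List (Subset n)) → κ≥ n 𝒮 (bound n 𝒮)
theorem2p3 n with even-or-odd n
... | inj₁ even =
  κ≥-bound-via (evenWeight (n / 2)) even (evenWeight-closed (n / 2)) (κ-Bound-even (n / 2))
... | inj₂ odd  =
  κ≥-bound-via (oddWeight (n / 2)) odd (oddWeight-closed (n / 2)) (κ-Bound-odd (n / 2))
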